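{- Let $A$ be a commutative algebra over a field containing $\mathbb{Q}(q)$ and $F(t)=\sum_{n\ge1}f_n\,t^n/[n]_q!\in A[[t]]$. Then $\mathbf{E}_q[F]^*_q=\sum_{n\ge0}\gamma^*_n\,t^n/[n]_q!$ if and only if \[ \gamma^*_0=1\quad\text{and}\quad \gamma^*_{n+1}=\sum_{k=0}^{n}\binom nk_q q^{n-k}\gamma^*_{n-k}f_{k+1}\ \text{ for all } n\ge0. \]
   Context: $[n]_q=1+q+\cdots+q^{n-1}$ ($n\ge1$), $[0]_q=0$, $[n]_q!=[1]_q\cdots[n]_q$, $[0]_q!=1$, $\binom nk_q=\frac{[n]_q!}{[k]_q![n-k]_q!}$; $D_qF(t)=\frac{F(qt)-F(t)}{(q-1)t}$. For $F$ with $F(0)=0$: $F^{[0]^*}=1$ and for $k\ge1$, $F^{[k]^*}$ is the unique series with zero constant term such that $D_qF^{[k]^*}(t)=[k]_q\,q^{ -(k-1)}F^{[k-1]^*}(qt)\,D_qF(t)$. For $G(t)=\sum_kg_kt^k/[k]_q!$, $G[F]^*_q=\sum_kg_kF^{[k]^*}/[k]_q!$. $\mathbf{E}_q(t)=\sum_{n\ge0}q^{\binom n2}t^n/[n]_q!$. -}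

module Defs where

open import Level using (_⊔_)
open import Data.Nat using (ℕ; zero; suc; _∸_)
open import Data.Nat.Combinatorics using (_C_)
open import Data.Integer using (ℤ; +_; -[1+_])
open import Data.List using (List; []; _∷_)
open import Data.List.Relation.Unary.All using (All)
open import Data.Product using (Σ; _×_)
open import Relation.Nullary using (¬_)
open import Relation.Binary.PropositionalEquality using (_≡_)
open import Algebra.Bundles using (CommutativeRing)
open import Algebra.Morphism.Structures using (module RingMorphisms)

module FieldDefs {c ℓ} (K : CommutativeRing c ℓ) where
  open CommutativeRing K

  IsField : Set (c ⊔ ℓ)
  IsField = (¬ (1# ≈ 0#)) × (∀ x → ¬ (x ≈ 0#) → Σ Carrier (λ y → x * y ≈ 1#))

  ofℕ : ℕ → Carrier
  ofℕ zero = 0#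
  ofℕ (suc n) = 1# + ofℕ n

  ofℤ : ℤ → Carrier
  ofℤ (+ n) = ofℕ n
  ofℤ -[1+ n ] = - ofℕ (suc n)

  evalℤ : List ℤ → Carrier → Carrier
  evalℤ [] x = 0#
  evalℤ (a ∷ as) x = ofℤ a + x * evalℤ as x

  -- q is transcendental over ℚ (this includes characteristic 0): no nonzero
  -- integer (equivalently rational) polynomial vanishes at q.  For a field K,
  -- this is exactly the statement that ℚ(q) ⊆ K.
  Transcendental : Carrier → Set ℓ
  Transcendental q = ∀ (cs : List ℤ) → ¬ All (_≡ + 0) cs → ¬ (evalℤ cs q ≈ 0#)

IsAlgebraMap : ∀ {c₁ ℓ₁ c₂ ℓ₂} (K : CommutativeRing c₁ ℓ₁) (A : CommutativeRing c₂ ℓ₂) →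
               (CommutativeRing.Carrier K → CommutativeRing.Carrier A) → Set _
IsAlgebraMap K A φ =
  RingMorphisms.IsRingHomomorphism (CommutativeRing.rawRing K) (CommutativeRing.rawRing A) φ

-- Formal power series over A, represented by their coefficient sequence
-- in the ordinary basis: a : ℕ → A stands for Σ a n tⁿ.
-- q is the element of A (image of q ∈ K), qinv its inverse, and
-- ι k an inverse of [k]_q! in A.

module QSeries {c ℓ} (A : CommutativeRing c ℓ) (q qinv : CommutativeRing.Carrier A)
               (ι : ℕ → CommutativeRing.Carrier A) where
  open CommutativeRing A

  Series : Set c
  Series = ℕ → Carrier

  pow : Carrier → ℕ → Carrier
  pow x zero = 1#
  pow x (suc n) = pow x n * x

  sumTo : ℕ → (ℕ → Carrier) → Carrier
  sumTo zero g = 0#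
  sumTo (suc n) g = sumTo n g + g n

  qint : ℕ → Carrier
  qint n = sumTo n (pow q)

  qfact : ℕ → Carrier
  qfact zero = 1#
  qfact (suc n) = qfact n * qint (suc n)

  -- q-binomial [n]_q! / ([k]_q! [n-k]_q!)   (used for k ≤ n)
  qbin : ℕ → ℕ → Carrier
  qbin n k = qfact n * ι k * ι (n ∸ k)

  mul : Series → Series → Series
  mul a b n = sumTo (suc n) (λ i → a i * b (n ∸ i))

  dil : Series → Series
  dil a n = pow q n * a n

  -- D_q F (t) = (F(qt) - F(t)) / ((q-1)t); coefficientwise tⁿ ↦ [n+1]_q a_{n+1}
  Dq : Series → Series
  Dq a n = qint (suc n) * a (suc n)

  Fser : (ℕ → Carrier) → Series
  Fser f zero = 0#
  Fser f (suc n) = f (suc n) * ι (suc n)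

  -- P k is F^{[k]*}: P 0 = 1, and for k ≥ 1, P k has zero constant term and
  -- D_q P k (t) = [k]_q q^{-(k-1)} P (k-1) (qt) · D_q F (t).
  IsCompPowers : (ℕ → Carrier) → (ℕ → Series) → Set ℓ
  IsCompPowers f P =
    (P 0 0 ≈ 1#) × (∀ n → P 0 (suc n) ≈ 0#) ×
    (∀ k → P (suc k) 0 ≈ 0#) ×
    (∀ k n → Dq (P (suc k)) n ≈ qint (suc k) * pow qinv k * mul (dil (P k)) (Dq (Fser f)) n)

  -- E_q[F]^*_q = Σ_k q^{binom k 2} F^{[k]*}/[k]_q! ; its tⁿ-coefficient is
  -- Σ_{k ≤ n} q^{binom k 2} (1/[k]_q!) (F^{[k]*})_n (terms k > n vanish since
  -- F^{[k]*} has order ≥ k).  Equality with Σ_n γ_n tⁿ/[n]_q!: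
  EqCompEquals : (ℕ → Series) → (ℕ → Carrier) → Set ℓ
  EqCompEquals P γ =
    ∀ n → sumTo (suc n) (λ k → pow q (k C 2) * ι k * P k n) ≈ γ n * ι n

  Recurrence : (ℕ → Carrier) → (ℕ → Carrier) → Set ℓ
  Recurrence f γ =
    (γ 0 ≈ 1#) ×
    (∀ n → γ (suc n) ≈ sumTo (suc n) (λ k → qbin n k * pow q (n ∸ k) * γ (n ∸ k) * f (suc k)))

-- Write E n for the tⁿ-coefficient of E_q[F]^*_q.  Applying D_q to the
-- defining relation of F^{[k]*} and summing against q^{binom k 2}/[k]_q!
-- gives the q-differential equation  D_q E(t) = E(qt) · D_q F(t),  because
-- q^{binom (k+1) 2} [k+1]_q q^{-k} / [k+1]_q! = q^{binom k 2} / [k]_q!.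
-- Comparing tⁿ-coefficients and putting γ*_n = [n]_q! E n turns this equation
-- into the recurrence (after reversing the order of summation), and the
-- recurrence has exactly one solution.

module Submission where

open import Defs
open import Data.Nat using (ℕ)
open import Function.Bundles using (_⇔_)
open import Algebra.Bundles using (CommutativeRing)

import Data.Nat as ℕ
open import Data.Nat using (zero; suc; _∸_; _≤_; _<_; z≤n; s≤s)
import Data.Nat.Properties as ℕₚ
open import Data.Nat.Combinatorics using (_C_; nC1≡n; nCk+nC[k+1]≡[n+1]C[k+1])
open import Data.Product using (_,_; proj₁; proj₂)
open import Data.Sum using (inj₁; inj₂)
open import Function.Bundles using (mk⇔; Equivalence)
open import Function.Construct.Composition using (_⇔-∘_)
open import Function.Properties.Equivalence using () renaming (sym to ⇔-sym)
open import Relation.Binary.PropositionalEquality as ≡ using (_≡_)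
import Algebra.Solver.CommutativeMonoid as CommutativeMonoidSolver
import Relation.Binary.Reasoning.Setoid as SetoidReasoning

module SeriesAlgebra {c ℓ} (A : CommutativeRing c ℓ) (q qinv : CommutativeRing.Carrier A)
                     (ι : ℕ → CommutativeRing.Carrier A) where
  open CommutativeRing A hiding (zero)
  open QSeries A q qinv ι
  open SetoidReasoning setoid
  open CommutativeMonoidSolver *-commutativeMonoid using (solve; _⊜_; _⊕_)

  sumTo-cong : ∀ n {g h : ℕ → Carrier} → (∀ k → k < n → g k ≈ h k) → sumTo n g ≈ sumTo n h
  sumTo-cong zero     eq = refl
  sumTo-cong (suc n) eq = +-cong (sumTo-cong n (λ k k<n → eq k (ℕₚ.m<n⇒m<1+n k<n))) (eq n (ℕₚ.n<1+n n))

  sumTo-zero : ∀ n → sumTo n (λ _ → 0#) ≈ 0#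
  sumTo-zero zero    = refl
  sumTo-zero (suc n) = trans (+-identityʳ _) (sumTo-zero n)

  sumTo-+ : ∀ n g h → sumTo n (λ k → g k + h k) ≈ sumTo n g + sumTo n h
  sumTo-+ zero    g h = sym (+-identityˡ 0#)
  sumTo-+ (suc n) g h = trans (+-congʳ (sumTo-+ n g h)) (interchange _ _ _ _)
    where
    open CommutativeMonoidSolver +-commutativeMonoid
      renaming (solve to +-solve; _⊜_ to _⊜⁺_; _⊕_ to _⊕⁺_)
    interchange : ∀ a b c d → (a + b) + (c + d) ≈ (a + c) + (b + d)
    interchange = +-solve 4 (λ a b c d → ((a ⊕⁺ b) ⊕⁺ (c ⊕⁺ d)) ⊜⁺ ((a ⊕⁺ c) ⊕⁺ (b ⊕⁺ d))) refl

  *-distribˡ-sumTo : ∀ n x g → x * sumTo n g ≈ sumTo n (λ k → x * g k)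
  *-distribˡ-sumTo zero    x g = zeroʳ x
  *-distribˡ-sumTo (suc n) x g = trans (distribˡ x _ _) (+-congʳ (*-distribˡ-sumTo n x g))

  *-distribʳ-sumTo : ∀ n x g → sumTo n g * x ≈ sumTo n (λ k → g k * x)
  *-distribʳ-sumTo zero    x g = zeroˡ x
  *-distribʳ-sumTo (suc n) x g = trans (distribʳ x _ _) (+-congʳ (*-distribʳ-sumTo n x g))

  sumTo-comm : ∀ n m (a : ℕ → ℕ → Carrier) →
    sumTo n (λ j → sumTo m (λ i → a j i)) ≈ sumTo m (λ i → sumTo n (λ j → a j i))
  sumTo-comm zero    m a = sym (sumTo-zero m)
  sumTo-comm (suc n) m a = trans (+-congʳ (sumTo-comm n m a)) (sym (sumTo-+ m _ _))

  sumTo-sucˡ : ∀ n g → sumTo (suc n) g ≈ g 0 + sumTo n (λ k → g (suc k))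
  sumTo-sucˡ zero    g = +-comm 0# (g 0)
  sumTo-sucˡ (suc n) g = trans (+-congʳ (sumTo-sucˡ n g)) (+-assoc _ _ _)

  sumTo-reverse : ∀ n g → sumTo (suc n) (λ k → g (n ∸ k)) ≈ sumTo (suc n) g
  sumTo-reverse zero    g = refl
  sumTo-reverse (suc n) g = begin
      sumTo (suc n) (λ k → g (suc n ∸ k)) + g (n ∸ n)
    ≈⟨ +-cong (sumTo-cong (suc n) (λ k k≤n → reflexive (≡.cong g (ℕₚ.+-∸-assoc 1 (ℕₚ.≤-pred k≤n)))))
              (reflexive (≡.cong g (ℕₚ.n∸n≡0 n))) ⟩
      sumTo (suc n) (λ k → g (suc (n ∸ k))) + g 0
    ≈⟨ +-congʳ (sumTo-reverse n (λ k → g (suc k))) ⟩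
      sumTo (suc n) (λ k → g (suc k)) + g 0
    ≈⟨ +-comm _ _ ⟩
      g 0 + sumTo (suc n) (λ k → g (suc k))
    ≈⟨ sym (sumTo-sucˡ (suc n) g) ⟩
      sumTo (suc (suc n)) g ∎

  sumTo-truncate : ∀ n m g → m ≤ n → (∀ k → m ≤ k → k < n → g k ≈ 0#) → sumTo n g ≈ sumTo m g
  sumTo-truncate zero    _ g z≤n    _      = refl
  sumTo-truncate (suc n) m g m≤1+n vanish with ℕₚ.m≤n⇒m<n∨m≡n m≤1+n
  ... | inj₂ ≡.refl = refl
  ... | inj₁ m<1+n  = begin
      sumTo n g + g n ≈⟨ +-cong (sumTo-truncate n m g m≤n (λ k m≤k k<n → vanish k m≤k (ℕₚ.m<n⇒m<1+n k<n)))
                                (vanish n m≤n (ℕₚ.n<1+n n)) ⟩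
      sumTo m g + 0#  ≈⟨ +-identityʳ _ ⟩
      sumTo m g       ∎
    where m≤n = ℕₚ.≤-pred m<1+n

  pow-+ : ∀ x a b → pow x (a ℕ.+ b) ≈ pow x a * pow x b
  pow-+ x zero    b = sym (*-identityˡ _)
  pow-+ x (suc a) b = trans (*-congʳ (pow-+ x a b))
    (solve 3 (λ u v w → ((u ⊕ v) ⊕ w) ⊜ ((u ⊕ w) ⊕ v)) refl (pow x a) (pow x b) x)

  pow-inverse : ∀ {x y} → x * y ≈ 1# → ∀ k → pow x k * pow y k ≈ 1#
  pow-inverse xy≈1 zero    = *-identityˡ 1#
  pow-inverse {x} {y} xy≈1 (suc k) = begin
      (pow x k * x) * (pow y k * y) ≈⟨ solve 4 (λ a b c d → ((a ⊕ b) ⊕ (c ⊕ d)) ⊜ ((a ⊕ c) ⊕ (b ⊕ d))) refl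
                                         (pow x k) x (pow y k) y ⟩
      (pow x k * pow y k) * (x * y) ≈⟨ *-cong (pow-inverse xy≈1 k) xy≈1 ⟩
      1# * 1#                       ≈⟨ *-identityˡ 1# ⟩
      1#                            ∎

  *-cancelˡ-invertible : ∀ {a b x y} → a * b ≈ 1# → b * x ≈ b * y → x ≈ y
  *-cancelˡ-invertible {a} {b} {x} {y} ab≈1 bx≈by = begin
      x           ≈⟨ sym (*-identityˡ x) ⟩
      1# * x      ≈⟨ *-congʳ (sym ab≈1) ⟩
      (a * b) * x ≈⟨ *-assoc a b x ⟩
      a * (b * x) ≈⟨ *-congˡ bx≈by ⟩
      a * (b * y) ≈⟨ sym (*-assoc a b y) ⟩
      (a * b) * y ≈⟨ *-congʳ ab≈1 ⟩
      1# * y      ≈⟨ *-identityˡ y ⟩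
      y           ∎

  *-inverse-transpose : ∀ {a b x y} → a * b ≈ 1# → (x ≈ b * y ⇔ y ≈ x * a)
  *-inverse-transpose {a} {b} {x} {y} ab≈1 = mk⇔
    (λ x≈by → begin
      y             ≈⟨ sym (*-identityˡ y) ⟩
      1# * y        ≈⟨ *-congʳ (sym ab≈1) ⟩
      (a * b) * y   ≈⟨ solve 3 (λ a b y → ((a ⊕ b) ⊕ y) ⊜ ((b ⊕ y) ⊕ a)) refl a b y ⟩
      (b * y) * a   ≈⟨ *-congʳ (sym x≈by) ⟩
      x * a         ∎)
    (λ y≈xa → begin
      x             ≈⟨ sym (*-identityʳ x) ⟩
      x * 1#        ≈⟨ *-congˡ (sym ab≈1) ⟩
      x * (a * b)   ≈⟨ solve 3 (λ x a b → (x ⊕ (a ⊕ b)) ⊜ (b ⊕ (x ⊕ a))) refl x a b ⟩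
      b * (x * a)   ≈⟨ *-congˡ (sym y≈xa) ⟩
      b * y         ∎)

  recSummand : (ℕ → Carrier) → (ℕ → Carrier) → ℕ → ℕ → Carrier
  recSummand f γ n k = qbin n k * pow q (n ∸ k) * γ (n ∸ k) * f (suc k)

  module _ (f : ℕ → Carrier) where

    Recurrence-cong : ∀ {γ δ} → (∀ n → γ n ≈ δ n) → Recurrence f γ → Recurrence f δ
    Recurrence-cong {γ} {δ} γ≈δ (γ₀ , γ-suc) = trans (sym (γ≈δ 0)) γ₀ , λ n → begin
        δ (suc n)                        ≈⟨ sym (γ≈δ (suc n)) ⟩
        γ (suc n)                        ≈⟨ γ-suc n ⟩
        sumTo (suc n) (recSummand f γ n) ≈⟨ sumTo-cong (suc n) (λ k _ → *-congʳ (*-congˡ (γ≈δ (n ∸ k)))) ⟩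
        sumTo (suc n) (recSummand f δ n) ∎

    Recurrence-unique : ∀ {γ δ} → Recurrence f γ → Recurrence f δ → ∀ n → γ n ≈ δ n
    Recurrence-unique {γ} {δ} (γ₀ , γ-suc) (δ₀ , δ-suc) n = bounded n n ℕₚ.≤-refl
      where
      bounded : ∀ n m → m ≤ n → γ m ≈ δ m
      bounded _       zero    _         = trans γ₀ (sym δ₀)
      bounded (suc n) (suc m) (s≤s m≤n) = begin
          γ (suc m)                        ≈⟨ γ-suc m ⟩
          sumTo (suc m) (recSummand f γ m) ≈⟨ sumTo-cong (suc m) (λ k _ →
                                                *-congʳ (*-congˡ (bounded n (m ∸ k) (ℕₚ.≤-trans (ℕₚ.m∸n≤m m k) m≤n)))) ⟩
          sumTo (suc m) (recSummand f δ m) ≈⟨ sym (δ-suc m) ⟩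
          δ (suc m)                        ∎

    Recurrence⇔pointwise : ∀ {γ δ} → Recurrence f δ → (Recurrence f γ ⇔ (∀ n → γ n ≈ δ n))
    Recurrence⇔pointwise recδ =
      mk⇔ (λ recγ → Recurrence-unique recγ recδ) (λ γ≈δ → Recurrence-cong (λ n → sym (γ≈δ n)) recδ)

module CompositionalExponential
  {c ℓ} (A : CommutativeRing c ℓ) (q qinv : CommutativeRing.Carrier A)
  (ι : ℕ → CommutativeRing.Carrier A)
  (qinv-inverse : CommutativeRing._≈_ A (CommutativeRing._*_ A qinv q) (CommutativeRing.1# A))
  (ι-inverse : ∀ k → CommutativeRing._≈_ A (CommutativeRing._*_ A (ι k) (QSeries.qfact A q qinv ι k))
                                           (CommutativeRing.1# A))
  (f : ℕ → CommutativeRing.Carrier A) (P : ℕ → ℕ → CommutativeRing.Carrier A)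
  (compPowers : QSeries.IsCompPowers A q qinv ι f P) where

  open CommutativeRing A hiding (zero)
  open QSeries A q qinv ι
  open SeriesAlgebra A q qinv ι
  open SetoidReasoning setoid
  open CommutativeMonoidSolver *-commutativeMonoid using (solve; _⊜_; _⊕_)

  ι-qint : ∀ m → qint (suc m) * ι (suc m) ≈ ι m
  ι-qint m = begin
      qint (suc m) * ι (suc m)                       ≈⟨ sym (*-identityˡ _) ⟩
      1# * (qint (suc m) * ι (suc m))                ≈⟨ *-congʳ (sym (ι-inverse m)) ⟩
      (ι m * qfact m) * (qint (suc m) * ι (suc m))   ≈⟨ solve 4 (λ a b c d → ((a ⊕ b) ⊕ (c ⊕ d)) ⊜ (a ⊕ (d ⊕ (b ⊕ c)))) refl
                                                          (ι m) (qfact m) (qint (suc m)) (ι (suc m)) ⟩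
      ι m * (ι (suc m) * qfact (suc m))              ≈⟨ *-congˡ (ι-inverse (suc m)) ⟩
      ι m * 1#                                       ≈⟨ *-identityʳ _ ⟩
      ι m                                            ∎

  Dq-Fser : ∀ m → Dq (Fser f) m ≈ f (suc m) * ι m
  Dq-Fser m = begin
      qint (suc m) * (f (suc m) * ι (suc m)) ≈⟨ solve 3 (λ a b c → (a ⊕ (b ⊕ c)) ⊜ (b ⊕ (a ⊕ c))) refl
                                                  (qint (suc m)) (f (suc m)) (ι (suc m)) ⟩
      f (suc m) * (qint (suc m) * ι (suc m)) ≈⟨ *-congˡ (ι-qint m) ⟩
      f (suc m) * ι m                        ∎

  weight : ℕ → Carrier
  weight k = pow q (k C 2) * ι k

  weight-suc : ∀ j → weight (suc j) * qint (suc j) * pow qinv j ≈ weight j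
  weight-suc j = begin
      pow q (suc j C 2) * ι (suc j) * qint (suc j) * pow qinv j
    ≈⟨ *-congʳ (*-congʳ (*-congʳ (trans (reflexive (≡.cong (pow q) binom-suc)) (pow-+ q j (j C 2))))) ⟩
      (pow q j * pow q (j C 2)) * ι (suc j) * qint (suc j) * pow qinv j
    ≈⟨ solve 5 (λ a b c d e → ((((a ⊕ b) ⊕ c) ⊕ d) ⊕ e) ⊜ ((e ⊕ a) ⊕ ((d ⊕ c) ⊕ b))) refl
         (pow q j) (pow q (j C 2)) (ι (suc j)) (qint (suc j)) (pow qinv j) ⟩
      (pow qinv j * pow q j) * ((qint (suc j) * ι (suc j)) * pow q (j C 2))
    ≈⟨ *-cong (pow-inverse qinv-inverse j) (*-congʳ (ι-qint j)) ⟩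
      1# * (ι j * pow q (j C 2))
    ≈⟨ trans (*-identityˡ _) (*-comm _ _) ⟩
      weight j ∎
    where
    binom-suc : suc j C 2 ≡ j ℕ.+ j C 2
    binom-suc = ≡.trans (≡.sym (nCk+nC[k+1]≡[n+1]C[k+1] j 1)) (≡.cong (ℕ._+ j C 2) (nC1≡n j))

  P₀₀ : P 0 0 ≈ 1#
  P₀₀ = proj₁ compPowers

  P₀-suc : ∀ n → P 0 (suc n) ≈ 0#
  P₀-suc = proj₁ (proj₂ compPowers)

  P-suc-0 : ∀ k → P (suc k) 0 ≈ 0#
  P-suc-0 = proj₁ (proj₂ (proj₂ compPowers))

  Dq-P-suc : ∀ k n → Dq (P (suc k)) n ≈ qint (suc k) * pow qinv k * mul (dil (P k)) (Dq (Fser f)) n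
  Dq-P-suc = proj₂ (proj₂ (proj₂ compPowers))

  -- The tⁱ-coefficient of D_q F^{[k+1]*} only involves coefficients of F^{[k]*} of
  -- degree ≤ i < k, and the factor [i+1]_q in front of it is invertible.
  P-order : ∀ k i → i < k → P k i ≈ 0#
  P-order (suc k) zero    _   = P-suc-0 k
  P-order (suc k) (suc i) i<k = *-cancelˡ-invertible (trans (*-assoc _ _ _) (ι-inverse (suc i))) (begin
      qint (suc i) * P (suc k) (suc i)
    ≈⟨ Dq-P-suc k i ⟩
      qint (suc k) * pow qinv k * mul (dil (P k)) (Dq (Fser f)) i
    ≈⟨ *-congˡ (trans (sumTo-cong (suc i) lower-terms) (sumTo-zero (suc i))) ⟩
      qint (suc k) * pow qinv k * 0#
    ≈⟨ trans (zeroʳ _) (sym (zeroʳ _)) ⟩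
      qint (suc i) * 0# ∎)
    where
    lower-terms : ∀ l → l < suc i → pow q l * P k l * Dq (Fser f) (i ∸ l) ≈ 0#
    lower-terms l l≤i = begin
        pow q l * P k l * Dq (Fser f) (i ∸ l) ≈⟨ *-congʳ (*-congˡ (P-order k l (ℕₚ.<-≤-trans l≤i (ℕₚ.≤-pred i<k)))) ⟩
        pow q l * 0# * Dq (Fser f) (i ∸ l)    ≈⟨ trans (*-congʳ (zeroʳ _)) (zeroˡ _) ⟩
        0#                                    ∎

  expComp : Series
  expComp n = sumTo (suc n) (λ k → weight k * P k n)

  expComp-extend : ∀ n i → i ≤ n → sumTo (suc n) (λ k → weight k * P k i) ≈ expComp i
  expComp-extend n i i≤n = sumTo-truncate (suc n) (suc i) _ (s≤s i≤n)
    (λ k i<k _ → trans (*-congˡ (P-order k i i<k)) (zeroʳ _))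

  Dq-expComp-summand : ∀ j n →
    qint (suc n) * (weight (suc j) * P (suc j) (suc n)) ≈ weight j * mul (dil (P j)) (Dq (Fser f)) n
  Dq-expComp-summand j n = begin
      qint (suc n) * (weight (suc j) * P (suc j) (suc n))
    ≈⟨ solve 3 (λ a b c → (a ⊕ (b ⊕ c)) ⊜ (b ⊕ (a ⊕ c))) refl (qint (suc n)) (weight (suc j)) (P (suc j) (suc n)) ⟩
      weight (suc j) * Dq (P (suc j)) n
    ≈⟨ *-congˡ (Dq-P-suc j n) ⟩
      weight (suc j) * (qint (suc j) * pow qinv j * M)
    ≈⟨ solve 4 (λ a b c d → (a ⊕ ((b ⊕ c) ⊕ d)) ⊜ (((a ⊕ b) ⊕ c) ⊕ d)) refl (weight (suc j)) (qint (suc j)) (pow qinv j) M ⟩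
      weight (suc j) * qint (suc j) * pow qinv j * M
    ≈⟨ *-congʳ (weight-suc j) ⟩
      weight j * M ∎
    where M = mul (dil (P j)) (Dq (Fser f)) n

  Dq-expComp : ∀ n → Dq expComp n ≈ mul (dil expComp) (Dq (Fser f)) n
  Dq-expComp n = begin
      qint (suc n) * expComp (suc n)
    ≈⟨ *-congˡ (trans (sumTo-sucˡ (suc n) _) (trans (+-congʳ constant-term) (+-identityˡ _))) ⟩
      qint (suc n) * sumTo (suc n) (λ j → weight (suc j) * P (suc j) (suc n))
    ≈⟨ trans (*-distribˡ-sumTo (suc n) _ _) (sumTo-cong (suc n) (λ j _ → Dq-expComp-summand j n)) ⟩
      sumTo (suc n) (λ j → weight j * sumTo (suc n) (λ i → pow q i * P j i * DF i))
    ≈⟨ sumTo-cong (suc n) (λ j _ → trans (*-distribˡ-sumTo (suc n) _ _) (sumTo-cong (suc n) (λ i _ →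
         solve 4 (λ w a p d → (w ⊕ ((a ⊕ p) ⊕ d)) ⊜ ((a ⊕ (w ⊕ p)) ⊕ d)) refl (weight j) (pow q i) (P j i) (DF i)))) ⟩
      sumTo (suc n) (λ j → sumTo (suc n) (λ i → pow q i * (weight j * P j i) * DF i))
    ≈⟨ sumTo-comm (suc n) (suc n) _ ⟩
      sumTo (suc n) (λ i → sumTo (suc n) (λ j → pow q i * (weight j * P j i) * DF i))
    ≈⟨ sumTo-cong (suc n) (λ i i≤n → begin
         sumTo (suc n) (λ j → pow q i * (weight j * P j i) * DF i)
           ≈⟨ sym (trans (*-congʳ (*-distribˡ-sumTo (suc n) (pow q i) _)) (*-distribʳ-sumTo (suc n) (DF i) _)) ⟩
         pow q i * sumTo (suc n) (λ j → weight j * P j i) * DF i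
           ≈⟨ *-congʳ (*-congˡ (expComp-extend n i (ℕₚ.≤-pred i≤n))) ⟩
         pow q i * expComp i * DF i ∎) ⟩
      mul (dil expComp) (Dq (Fser f)) n ∎
    where
    DF : ℕ → Carrier
    DF i = Dq (Fser f) (n ∸ i)
    constant-term : weight 0 * P 0 (suc n) ≈ 0#
    constant-term = trans (*-congˡ (P₀-suc n)) (zeroʳ _)

  normalised : ℕ → Carrier
  normalised n = qfact n * expComp n

  EqCompEquals⇔normalised : ∀ γ → EqCompEquals P γ ⇔ (∀ n → γ n ≈ normalised n)
  EqCompEquals⇔normalised γ = mk⇔
    (λ eq n → Equivalence.from (*-inverse-transpose (ι-inverse n)) (eq n))
    (λ γ≈ n → Equivalence.to (*-inverse-transpose (ι-inverse n)) (γ≈ n))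

  recSummand-reversed : ∀ n i → i ≤ n →
    recSummand f normalised n (n ∸ i) ≈ qfact n * (pow q i * expComp i * Dq (Fser f) (n ∸ i))
  recSummand-reversed n i i≤n rewrite ℕₚ.m∸[m∸n]≡n i≤n = begin
      qfact n * ι (n ∸ i) * ι i * pow q i * (qfact i * expComp i) * f (suc (n ∸ i))
    ≈⟨ solve 7 (λ a b c d e g h → (((((a ⊕ b) ⊕ c) ⊕ d) ⊕ (e ⊕ g)) ⊕ h) ⊜ ((c ⊕ e) ⊕ (a ⊕ ((d ⊕ g) ⊕ (h ⊕ b))))) refl
         (qfact n) (ι (n ∸ i)) (ι i) (pow q i) (qfact i) (expComp i) (f (suc (n ∸ i))) ⟩
      (ι i * qfact i) * (qfact n * (pow q i * expComp i * (f (suc (n ∸ i)) * ι (n ∸ i))))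
    ≈⟨ trans (*-congʳ (ι-inverse i)) (*-identityˡ _) ⟩
      qfact n * (pow q i * expComp i * (f (suc (n ∸ i)) * ι (n ∸ i)))
    ≈⟨ *-congˡ (*-congˡ (sym (Dq-Fser (n ∸ i)))) ⟩
      qfact n * (pow q i * expComp i * Dq (Fser f) (n ∸ i)) ∎

  normalised-recurrence : Recurrence f normalised
  normalised-recurrence = normalised-0 , normalised-suc
    where
    normalised-0 : normalised 0 ≈ 1#
    normalised-0 = begin
      1# * (0# + 1# * ι 0 * P 0 0) ≈⟨ trans (*-identityˡ _) (+-identityˡ _) ⟩
      1# * ι 0 * P 0 0             ≈⟨ *-cong (trans (*-identityˡ _) (trans (sym (*-identityʳ _)) (ι-inverse 0))) P₀₀ ⟩
      1# * 1#                      ≈⟨ *-identityˡ _ ⟩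
      1#                           ∎
    normalised-suc : ∀ n → normalised (suc n) ≈ sumTo (suc n) (recSummand f normalised n)
    normalised-suc n = begin
      (qfact n * qint (suc n)) * expComp (suc n)         ≈⟨ *-assoc _ _ _ ⟩
      qfact n * Dq expComp n                             ≈⟨ *-congˡ (Dq-expComp n) ⟩
      qfact n * mul (dil expComp) (Dq (Fser f)) n        ≈⟨ *-distribˡ-sumTo (suc n) _ _ ⟩
      sumTo (suc n) (λ i → qfact n * (pow q i * expComp i * Dq (Fser f) (n ∸ i)))
        ≈⟨ sumTo-cong (suc n) (λ i i≤n → sym (recSummand-reversed n i (ℕₚ.≤-pred i≤n))) ⟩
      sumTo (suc n) (λ i → recSummand f normalised n (n ∸ i))
        ≈⟨ sumTo-reverse n (recSummand f normalised n) ⟩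
      sumTo (suc n) (recSummand f normalised n) ∎

proposition6p6 : ∀ {c₁ ℓ₁ c₂ ℓ₂} (K : CommutativeRing c₁ ℓ₁) → FieldDefs.IsField K →
    (q : CommutativeRing.Carrier K) → FieldDefs.Transcendental K q →
    (A : CommutativeRing c₂ ℓ₂) (φ : CommutativeRing.Carrier K → CommutativeRing.Carrier A) →
    IsAlgebraMap K A φ →
    (qinv : CommutativeRing.Carrier A) →
    CommutativeRing._≈_ A (CommutativeRing._*_ A qinv (φ q)) (CommutativeRing.1# A) →
    (ι : ℕ → CommutativeRing.Carrier A) →
    (∀ k → CommutativeRing._≈_ A (CommutativeRing._*_ A (ι k) (QSeries.qfact A (φ q) qinv ι k)) (CommutativeRing.1# A)) →
    (f γ : ℕ → CommutativeRing.Carrier A) →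
    (P : ℕ → ℕ → CommutativeRing.Carrier A) → QSeries.IsCompPowers A (φ q) qinv ι f P →
    (QSeries.EqCompEquals A (φ q) qinv ι P γ ⇔ QSeries.Recurrence A (φ q) qinv ι f γ)
proposition6p6 K _ q _ A φ _ qinv qinv-inverse ι ι-inverse f γ P compPowers =
  ⇔-sym (Recurrence⇔pointwise f normalised-recurrence) ⇔-∘ EqCompEquals⇔normalised γ
  where
  open SeriesAlgebra A (φ q) qinv ι
  open CompositionalExponential A (φ q) qinv ι qinv-inverse ι-inverse f P compPowers
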